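{- Let $t\ge 1$ and $q\ge 0$ be integers, and let $L=(\ell_1,\dots,\ell_d)$ be a sequence obtained from the short sequence $L_m$ by iteratively applying the operation $\mathcal{M}$ (defined below), and consider applying $\mathcal{M}$ once more to $L$, with $i$ the index chosen in the definition of $\mathcal{M}$ (and $\ell_{d+1}=0$). Then: (i) if $i$ is chosen because of condition (b) (i.e. $\ell_i=\ell_{i+1}=3$), then $\ell_j=2$ for all $j<i$; (ii) if $\ell_{i+1}=0$, then $\ell_i\ge 4$.
   Context: Let $a=\lfloor\log_2(2q+3)\rfloor$. The short sequence is $L_m=(\ell_1,\dots,\ell_{a-1})$ with $\ell_i=2^{i+1}$ for $1\le i\le a-2$ and $\ell_{a-1}=2q-2^a+4$. The operation $\mathcal{M}$ on a sequence $L=(\ell_1,\dots,\ell_d)$ of positive integers: set $\ell_{d+1}=0$; let $i$ be the smallest index such that $\ell_i\ge 3$ and either (a) $2(\ell_i-1)>\ell_{i+1}+1$, or (b) $\ell_i=\ell_{i+1}=3$. Then $\mathcal{M}(L)$ is obtained by replacing $\ell_i$ by $\ell_i-1$ and $\ell_{i+1}$ by $\ell_{i+1}+1$, leaving all other terms unchanged (a final term equal to $0$ is dropped, so the length increases to $d+1$ exactly when $i=d$). -}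

module Defs where

open import Data.Nat using (ℕ; zero; suc; _+_; _*_; _∸_; _^_; _≤_; _<_)
open import Data.Nat.Logarithm using (⌊log₂_⌋)
open import Data.List using (List; []; _∷_; _++_; length; applyUpTo)
open import Data.Product using (_×_)
open import Data.Sum using (_⊎_)
open import Relation.Binary.PropositionalEquality using (_≡_)
open import Relation.Nullary using (¬_)

aOf : ℕ → ℕ
aOf q = ⌊log₂ (2 * q + 3) ⌋

-- short sequence L_m = (ℓ_1,…,ℓ_{a-1}), ℓ_i = 2^{i+1} (1 ≤ i ≤ a-2),
-- ℓ_{a-1} = 2q - 2^a + 4  (nonnegative since 2^a ≤ 2q+3)
shortSeqAux : ℕ → ℕ → List ℕ
shortSeqAux q zero = []
shortSeqAux q (suc zero) = []
shortSeqAux q (suc (suc b)) =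
  applyUpTo (λ k → 2 ^ (k + 2)) b ++ ((2 * q + 4) ∸ 2 ^ (suc (suc b)) ∷ [])

shortSeq : ℕ → List ℕ
shortSeq q = shortSeqAux q (aOf q)

-- 1-based lookup with default 0: get L j = ℓ_j for 1 ≤ j ≤ d, and 0 otherwise
-- (in particular ℓ_{d+1} = 0).
get : List ℕ → ℕ → ℕ
get [] _ = 0
get (x ∷ xs) zero = 0
get (x ∷ xs) (suc zero) = x
get (x ∷ xs) (suc (suc j)) = get xs (suc j)

CondB : List ℕ → ℕ → Set
CondB L i = get L i ≡ 3 × get L (suc i) ≡ 3

Admissible : List ℕ → ℕ → Set
Admissible L i =
  1 ≤ i × i ≤ length L × 3 ≤ get L i ×
  ((get L (suc i) + 1 < 2 * (get L i ∸ 1)) ⊎ CondB L i)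

Chosen : List ℕ → ℕ → Set
Chosen L i = Admissible L i × (∀ j → j < i → ¬ Admissible L j)

modifyAt : ℕ → List ℕ → List ℕ
modifyAt (suc zero) (x ∷ []) = (x ∸ 1) ∷ 1 ∷ []
modifyAt (suc zero) (x ∷ y ∷ r) = (x ∸ 1) ∷ suc y ∷ r
modifyAt (suc (suc k)) (x ∷ r) = x ∷ modifyAt (suc k) r
modifyAt _ L = L

data Reachable (q : ℕ) : List ℕ → Set where
  base : Reachable q (shortSeq q)
  step : ∀ {L} i → Reachable q L → Chosen L i → Reachable q (modifyAt i L)

-- Along the iteration of 𝓜 every term except the last stays ≥ 2, the last term stays ≥ 1,
-- and the total sum is invariant, hence even (the terms of L_m are even).  If the chosen
-- index i has ℓ_i ≤ 3, then minimality of i forces ℓ_j ≤ 2, i.e. ℓ_j = 2, for all j < i: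
-- otherwise the largest j < i with ℓ_j ≥ 3 would satisfy (a) or (b).
-- For (ii), ℓ_{i+1} = 0 means i = d; if ℓ_d were 3 the sum 2(d - 1) + 3 would be odd.
module Submission where

open import Defs
open import Data.Nat using (ℕ; zero; suc; _+_; _*_; _∸_; _^_; _≤_; _<_; z≤n; s≤s; NonZero; ⌊_/2⌋; ⌈_/2⌉; _≤?_; _<?_)
open import Data.Nat.Properties
open import Data.Nat.Divisibility using (_∣_; divides; ∣-refl; _∣0; m∣m*n; ∣m∣n⇒∣m+n; ∣m+n∣m⇒∣n)
open import Data.Nat.Logarithm using (⌊log₂_⌋)
open import Data.Nat.Logarithm.Core using (⌊log2⌋)
open import Data.Nat.ListAction using (sum)
open import Data.Nat.ListAction.Properties using (sum-++)
open import Data.List using (List; []; _∷_; _++_; length; applyUpTo)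
open import Data.List.Relation.Unary.All using (All; []; _∷_)
open import Data.List.Relation.Unary.All.Properties using (applyUpTo⁺₂)
open import Data.Product using (_×_; _,_)
open import Data.Sum using (_⊎_; inj₁; inj₂)
open import Induction.WellFounded using (Acc; acc)
open import Relation.Nullary using (¬_; yes; no; contradiction)
open import Relation.Binary.PropositionalEquality using (_≡_; refl; sym; trans; cong; subst)

2*⌊n/2⌋≤n : ∀ n → 2 * ⌊ n /2⌋ ≤ n
2*⌊n/2⌋≤n n = begin
  ⌊ n /2⌋ + (⌊ n /2⌋ + 0) ≡⟨ cong (⌊ n /2⌋ +_) (+-identityʳ ⌊ n /2⌋) ⟩
  ⌊ n /2⌋ + ⌊ n /2⌋       ≤⟨ +-monoʳ-≤ ⌊ n /2⌋ (⌊n/2⌋≤⌈n/2⌉ n) ⟩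
  ⌊ n /2⌋ + ⌈ n /2⌉       ≡⟨ ⌊n/2⌋+⌈n/2⌉≡n n ⟩
  n                       ∎
  where open ≤-Reasoning

2^⌊log2⌋n≤n : ∀ n .{{_ : NonZero n}} (ac : Acc _<_ n) → 2 ^ ⌊log2⌋ n ac ≤ n
2^⌊log2⌋n≤n 1 _ = ≤-refl
2^⌊log2⌋n≤n (suc (suc n)) (acc rs) = begin
  2 * 2 ^ ⌊log2⌋ (suc ⌊ n /2⌋) _ ≤⟨ *-monoʳ-≤ 2 (2^⌊log2⌋n≤n (suc ⌊ n /2⌋) _) ⟩
  2 * suc ⌊ n /2⌋                ≡⟨ *-suc 2 ⌊ n /2⌋ ⟩
  2 + 2 * ⌊ n /2⌋                ≤⟨ +-monoʳ-≤ 2 (2*⌊n/2⌋≤n n) ⟩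
  2 + n                          ∎
  where open ≤-Reasoning

2^⌊log₂n⌋≤n : ∀ n .{{_ : NonZero n}} → 2 ^ ⌊log₂ n ⌋ ≤ n
2^⌊log₂n⌋≤n n = 2^⌊log2⌋n≤n n _

2^a≤2q+3 : ∀ q → 2 ^ aOf q ≤ 2 * q + 3
2^a≤2q+3 q = subst (λ n → 2 ^ ⌊log₂ n ⌋ ≤ n) (+-comm 3 (2 * q)) (2^⌊log₂n⌋≤n (3 + 2 * q))

data WellShaped : List ℕ → Set where
  []  : WellShaped []
  [_] : ∀ {x} → 1 ≤ x → WellShaped (x ∷ [])
  _∷_ : ∀ {x y r} → 2 ≤ x → WellShaped (y ∷ r) → WellShaped (x ∷ y ∷ r)

wellShaped-++-[] : ∀ {xs c} → All (2 ≤_) xs → 1 ≤ c → WellShaped (xs ++ c ∷ [])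
wellShaped-++-[] [] 1≤c = [ 1≤c ]
wellShaped-++-[] (2≤x ∷ []) 1≤c = 2≤x ∷ [ 1≤c ]
wellShaped-++-[] (2≤x ∷ 2≤y ∷ all) 1≤c = 2≤x ∷ wellShaped-++-[] (2≤y ∷ all) 1≤c

wellShaped-incrHead : ∀ {y r} → WellShaped (y ∷ r) → WellShaped (suc y ∷ r)
wellShaped-incrHead [ _ ] = [ s≤s z≤n ]
wellShaped-incrHead (2≤y ∷ ws) = m≤n⇒m≤1+n 2≤y ∷ ws

wellShaped-modifyAt : ∀ {L} i → WellShaped L → 1 ≤ i → i ≤ length L → 3 ≤ get L i →
                      WellShaped (modifyAt i L)
wellShaped-modifyAt 1 [ _ ] _ _ 3≤x = ∸-monoˡ-≤ 1 3≤x ∷ [ s≤s z≤n ]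
wellShaped-modifyAt 1 (_ ∷ ws) _ _ 3≤x = ∸-monoˡ-≤ 1 3≤x ∷ wellShaped-incrHead ws
wellShaped-modifyAt (suc (suc i)) [ _ ] _ (s≤s ()) _
wellShaped-modifyAt 2 (2≤x ∷ ws@([ _ ])) _ i≤d 3≤ℓ = 2≤x ∷ wellShaped-modifyAt 1 ws (s≤s z≤n) (≤-pred i≤d) 3≤ℓ
wellShaped-modifyAt 2 (2≤x ∷ ws@(_ ∷ _)) _ i≤d 3≤ℓ = 2≤x ∷ wellShaped-modifyAt 1 ws (s≤s z≤n) (≤-pred i≤d) 3≤ℓ
wellShaped-modifyAt (suc (suc i@(suc _))) (2≤x ∷ ws) _ i≤d 3≤ℓ =
  2≤x ∷ wellShaped-modifyAt (suc i) ws (s≤s z≤n) (≤-pred i≤d) 3≤ℓ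

wellShaped⇒2≤get : ∀ {L} → WellShaped L → ∀ j → 1 ≤ j → j < length L → 2 ≤ get L j
wellShaped⇒2≤get [ _ ] (suc _) _ (s≤s ())
wellShaped⇒2≤get (2≤x ∷ _) 1 _ _ = 2≤x
wellShaped⇒2≤get (_ ∷ ws) (suc (suc j)) _ j<d = wellShaped⇒2≤get ws (suc j) (s≤s z≤n) (≤-pred j<d)

wellShaped⇒1≤get : ∀ {L} → WellShaped L → ∀ j → 1 ≤ j → j ≤ length L → 1 ≤ get L j
wellShaped⇒1≤get [ 1≤x ] 1 _ _ = 1≤x
wellShaped⇒1≤get [ _ ] (suc (suc _)) _ (s≤s ())
wellShaped⇒1≤get (2≤x ∷ _) 1 _ _ = ≤-trans (s≤s z≤n) 2≤x
wellShaped⇒1≤get (_ ∷ ws) (suc (suc j)) _ j≤d = wellShaped⇒1≤get ws (suc j) (s≤s z≤n) (≤-pred j≤d)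

wellShaped-get-suc≡0 : ∀ {L i} → WellShaped L → i ≤ length L → get L (suc i) ≡ 0 → i ≡ length L
wellShaped-get-suc≡0 {L} {i} ws i≤d ℓ≡0 with i <? length L
... | yes i<d = contradiction (subst (1 ≤_) ℓ≡0 (wellShaped⇒1≤get ws (suc i) (s≤s z≤n) i<d)) λ ()
... | no i≮d = ≤-antisym i≤d (≮⇒≥ i≮d)

sum-modifyAt : ∀ i L → 1 ≤ i → i ≤ length L → 1 ≤ get L i → sum (modifyAt i L) ≡ sum L
sum-modifyAt 1 (suc x ∷ []) _ _ _ = trans (+-comm x 1) (cong suc (sym (+-identityʳ x)))
sum-modifyAt 1 (suc x ∷ y ∷ r) _ _ _ = +-suc x (y + sum r)
sum-modifyAt (suc (suc i)) (x ∷ r) _ i≤d 1≤ℓ = cong (x +_) (sum-modifyAt (suc i) r (s≤s z≤n) (≤-pred i≤d) 1≤ℓ)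

All-∣⇒∣sum : ∀ {d xs} → All (d ∣_) xs → d ∣ sum xs
All-∣⇒∣sum [] = _ ∣0
All-∣⇒∣sum (d∣x ∷ all) = ∣m∣n⇒∣m+n d∣x (All-∣⇒∣sum all)

¬2∣3 : ¬ 2 ∣ 3
¬2∣3 (divides (suc (suc _)) ())

¬2All-∣⇒∣sum-twos-then-three : ∀ L → (∀ j → 1 ≤ j → j < length L → get L j ≡ 2) →
                         get L (length L) ≡ 3 → ¬ 2 ∣ sum L
¬2All-∣⇒∣sum-twos-then-three (x ∷ []) _ refl = ¬2∣3
¬2All-∣⇒∣sum-twos-then-three (x ∷ y ∷ r) twos ℓ≡3 2All-∣⇒∣sum =
  ¬2All-∣⇒∣sum-twos-then-three (y ∷ r) (λ { (suc j) _ j<d → twos (suc (suc j)) (s≤s z≤n) (s≤s j<d) }) ℓ≡3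
    (∣m+n∣m⇒∣n 2All-∣⇒∣sum (subst (2 ∣_) (sym (twos 1 (s≤s z≤n) (s≤s (s≤s z≤n)))) ∣-refl))

2^[k+2]≡2*2^[k+1] : ∀ k → 2 ^ (k + 2) ≡ 2 * 2 ^ suc k
2^[k+2]≡2*2^[k+1] k = cong (2 ^_) (+-comm k 2)

shortSeqAux-wellShaped : ∀ q a → 2 ^ a ≤ 2 * q + 3 → WellShaped (shortSeqAux q a)
shortSeqAux-wellShaped q 0 _ = []
shortSeqAux-wellShaped q 1 _ = []
shortSeqAux-wellShaped q (suc (suc b)) 2^a≤ = wellShaped-++-[] (applyUpTo⁺₂ _ b 2≤2^[k+2]) (m<n⇒0<n∸m 2^a<)
  where
  2≤2^[k+2] : ∀ k → 2 ≤ 2 ^ (k + 2)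
  2≤2^[k+2] k = subst (2 ≤_) (sym (2^[k+2]≡2*2^[k+1] k)) (*-monoʳ-≤ 2 (m^n>0 2 (suc k)))
  2^a< : 2 ^ suc (suc b) < 2 * q + 4
  2^a< = subst (2 ^ suc (suc b) <_) (sym (+-suc (2 * q) 3)) (s≤s 2^a≤)

shortSeqAux-even : ∀ q a → 2 ^ a ≤ 2 * q + 3 → 2 ∣ sum (shortSeqAux q a)
shortSeqAux-even q 0 _ = 2 ∣0
shortSeqAux-even q 1 _ = 2 ∣0
shortSeqAux-even q (suc (suc b)) 2^a≤ =
  subst (2 ∣_) (sym (sum-++ (applyUpTo _ b) _)) (∣m∣n⇒∣m+n (All-∣⇒∣sum (applyUpTo⁺₂ _ b 2∣2^[k+2])) 2∣last+0)
  where
  2∣2^[k+2] : ∀ k → 2 ∣ 2 ^ (k + 2)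
  2∣2^[k+2] k = subst (2 ∣_) (sym (2^[k+2]≡2*2^[k+1] k)) (m∣m*n (2 ^ suc k))
  2^a≤2q+4 : 2 ^ suc (suc b) ≤ 2 * q + 4
  2^a≤2q+4 = subst (2 ^ suc (suc b) ≤_) (sym (+-suc (2 * q) 3)) (m≤n⇒m≤1+n 2^a≤)
  2∣2q+4 : 2 ∣ 2 * q + 4
  2∣2q+4 = subst (2 ∣_) (*-distribˡ-+ 2 q 2) (m∣m*n (q + 2))
  2∣last+0 : 2 ∣ ((2 * q + 4) ∸ 2 ^ suc (suc b)) + 0
  2∣last+0 = subst (2 ∣_) (sym (+-identityʳ _))
    (∣m+n∣m⇒∣n (subst (2 ∣_) (sym (m+[n∸m]≡n 2^a≤2q+4)) 2∣2q+4) (m∣m*n (2 ^ suc b)))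

reachable⇒wellShaped : ∀ {q L} → Reachable q L → WellShaped L
reachable⇒wellShaped {q} base = shortSeqAux-wellShaped q (aOf q) (2^a≤2q+3 q)
reachable⇒wellShaped (step i r ((1≤i , i≤d , 3≤ℓ , _) , _)) =
  wellShaped-modifyAt i (reachable⇒wellShaped r) 1≤i i≤d 3≤ℓ

reachable⇒even : ∀ {q L} → Reachable q L → 2 ∣ sum L
reachable⇒even {q} base = shortSeqAux-even q (aOf q) (2^a≤2q+3 q)
reachable⇒even (step {L} i r ((1≤i , i≤d , 3≤ℓ , _) , _)) =
  subst (2 ∣_) (sym (sum-modifyAt i L 1≤i i≤d (≤-trans (s≤s z≤n) 3≤ℓ))) (reachable⇒even r)

3≤g⇒condA⊎condB : ∀ {g h} → 3 ≤ g → h ≤ 3 → (h + 1 < 2 * (g ∸ 1)) ⊎ (g ≡ 3 × h ≡ 3)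
3≤g⇒condA⊎condB {1} (s≤s ()) _
3≤g⇒condA⊎condB {2} (s≤s (s≤s ())) _
3≤g⇒condA⊎condB {3} _ z≤n = inj₁ (s≤s (s≤s z≤n))
3≤g⇒condA⊎condB {3} _ (s≤s z≤n) = inj₁ (s≤s (s≤s (s≤s z≤n)))
3≤g⇒condA⊎condB {3} _ (s≤s (s≤s z≤n)) = inj₁ (s≤s (s≤s (s≤s (s≤s z≤n))))
3≤g⇒condA⊎condB {3} _ (s≤s (s≤s (s≤s z≤n))) = inj₂ (refl , refl)
3≤g⇒condA⊎condB {suc (suc (suc (suc g)))} {h} _ h≤3 = inj₁ (begin-strict
  h + 1                 ≤⟨ +-monoˡ-≤ 1 h≤3 ⟩
  4                     <⟨ s≤s (s≤s (s≤s (s≤s (s≤s z≤n)))) ⟩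
  6                     ≤⟨ *-monoʳ-≤ 2 (s≤s (s≤s (s≤s z≤n))) ⟩
  2 * suc (suc (suc g)) ∎)
  where open ≤-Reasoning

chosen⇒≤2-below : ∀ {L i} → Chosen L i → get L i ≤ 3 → ∀ j → 1 ≤ j → j < i → get L j ≤ 2
chosen⇒≤2-below {L} {i} ((_ , i≤d , _) , minimal) ℓᵢ≤3 j 1≤j j<i = go (i ∸ suc j) j 1≤j (m+[n∸m]≡n j<i)
  where
  go : ∀ k m → 1 ≤ m → suc m + k ≡ i → get L m ≤ 2
  go k m 1≤m m+k≡i with 3 ≤? get L m
  ... | no ℓₘ≱3 = ≤-pred (≰⇒> ℓₘ≱3)
  ... | yes 3≤ℓₘ = contradiction
    (1≤m , ≤-trans (<⇒≤ m<i) i≤d , 3≤ℓₘ , 3≤g⇒condA⊎condB 3≤ℓₘ (next≤3 k m+k≡i)) (minimal m m<i)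
    where
    m<i : m < i
    m<i = subst (m <_) m+k≡i (m≤m+n (suc m) k)
    next≤3 : ∀ k → suc m + k ≡ i → get L (suc m) ≤ 3
    next≤3 zero m+1≡i = subst (λ n → get L n ≤ 3) (sym (trans (sym (+-identityʳ (suc m))) m+1≡i)) ℓᵢ≤3
    next≤3 (suc k′) m+k≡i = m≤n⇒m≤1+n (go k′ (suc m) (s≤s z≤n) (trans (sym (+-suc (suc m) k′)) m+k≡i))

chosen-three⇒twos-below : ∀ {L i} → WellShaped L → Chosen L i → get L i ≡ 3 →
                          ∀ j → 1 ≤ j → j < i → get L j ≡ 2
chosen-three⇒twos-below {L} ws ch@((_ , i≤d , _) , _) ℓᵢ≡3 j 1≤j j<i =
  ≤-antisym (chosen⇒≤2-below {L} ch (≤-reflexive ℓᵢ≡3) j 1≤j j<i)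
            (wellShaped⇒2≤get ws j 1≤j (<-≤-trans j<i i≤d))

-- The paper's parameter t does not enter the argument.
lemma2p5 : (t q : ℕ) → 1 ≤ t → (L : List ℕ) → Reachable q L →
    (i : ℕ) → Chosen L i →
    (CondB L i → ∀ j → 1 ≤ j → j < i → get L j ≡ 2) ×
    (get L (suc i) ≡ 0 → 4 ≤ get L i)
lemma2p5 _ _ _ L r i ch@((_ , i≤d , 3≤ℓᵢ , _) , _) = part-i , part-ii
  where
  ws : WellShaped L
  ws = reachable⇒wellShaped r
  part-i : CondB L i → ∀ j → 1 ≤ j → j < i → get L j ≡ 2
  part-i (ℓᵢ≡3 , _) = chosen-three⇒twos-below ws ch ℓᵢ≡3
  part-ii : get L (suc i) ≡ 0 → 4 ≤ get L i
  part-ii ℓᵢ₊₁≡0 with 4 ≤? get L i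
  ... | yes 4≤ℓᵢ = 4≤ℓᵢ
  ... | no ℓᵢ≱4 = contradiction (reachable⇒even r)
    (¬2All-∣⇒∣sum-twos-then-three L (λ j 1≤j j<d → twos j 1≤j (subst (j <_) (sym i≡d) j<d))
                              (subst (λ n → get L n ≡ 3) i≡d ℓᵢ≡3))
    where
    ℓᵢ≡3 : get L i ≡ 3
    ℓᵢ≡3 = ≤-antisym (≤-pred (≰⇒> ℓᵢ≱4)) 3≤ℓᵢ
    i≡d : i ≡ length L
    i≡d = wellShaped-get-suc≡0 ws i≤d ℓᵢ₊₁≡0
    twos : ∀ j → 1 ≤ j → j < i → get L j ≡ 2
    twos = chosen-three⇒twos-below ws ch ℓᵢ≡3
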